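{- Let $k\geq 2$ and let $p=(p_1,\ldots,p_k)$ and $q=(q_1,\ldots,q_k)$ be arrays of positive integers such that $p \succ q$ and $p_1+\cdots+p_k = q_1+\cdots+q_k = n-1$. Then $$ecc(S(p_1,p_2,\ldots,p_k)) \geq ecc(S(q_1,q_2,\ldots,q_k)).$$
   Context: For a connected graph $H$ on vertex set $V$ with $|V|=n$, $\varepsilon(v)=\max_{u\in V} d(u,v)$ and $ecc(H)=\frac{1}{n}\sum_{v\in V}\varepsilon(v)$. For integers $n_1\geq n_2\geq\cdots\geq n_k\geq 1$, $S(n_1,\ldots,n_k)$ denotes the tree on $n=n_1+\cdots+n_k+1$ vertices having a vertex $v$ such that $S(n_1,\ldots,n_k)-v$ is the disjoint union of paths $P_{n_1},\ldots,P_{n_k}$, where $v$ is adjacent to exactly one end vertex of each of these paths. For integer arrays $x=(x_1,\ldots,x_k)$, $y=(y_1,\ldots,y_k)$, $x \succ y$ ($x$ majorizes $y$) means: $x_1\geq\cdots\geq x_k$ and $y_1\geq\cdots\geq y_k$; $x_1+\cdots+x_j\geq y_1+\cdots+y_j$ for every $1\leq j<k$; and $x_1+\cdots+x_k=y_1+\cdots+y_k$. -}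

module Defs where

open import Data.Nat using (ℕ; zero; suc; _+_; _∸_; _≤_; _<_; _⊔_; _≡ᵇ_)
open import Data.Bool using (Bool; true; false; _∧_; _∨_; if_then_else_)
open import Data.Fin using (Fin; toℕ)
open import Data.List using (List; []; _∷_; _++_; map; foldr; allFin; take; upTo)
open import Data.Nat.ListAction using (sum)
open import Data.Bool.ListAction using (any)
open import Data.Vec using (Vec; toList)
open import Data.Product using (_×_; _,_)
open import Data.Integer using (+_)
open import Data.Rational using (ℚ; _/_)
open import Relation.Binary.PropositionalEquality using (_≡_)

Adj : ℕ → Set
Adj N = Fin N → Fin N → Bool

reach : ∀ {N} → Adj N → ℕ → Fin N → Fin N → Bool
reach adj zero    u v = toℕ u ≡ᵇ toℕ v
reach {N} adj (suc m) u v =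
  reach adj m u v ∨ any (λ w → reach adj m u w ∧ adj w v) (allFin N)

firstTrue : (ℕ → Bool) → ℕ → ℕ → ℕ
firstTrue f zero       i = i
firstTrue f (suc fuel) i = if f i then i else firstTrue f fuel (suc i)

-- graph distance d(u,v): the least m such that a walk (hence a path) of
-- length m joins u and v.  In a connected graph on N vertices this is ≤ N-1,
-- so searching m = 0..N suffices.
dist : ∀ {N} → Adj N → Fin N → Fin N → ℕ
dist {N} adj u v = firstTrue (λ m → reach adj m u v) N 0

maxL : List ℕ → ℕ
maxL = foldr _⊔_ 0

eccV : ∀ {N} → Adj N → Fin N → ℕ
eccV {N} adj v = maxL (map (λ u → dist adj u v) (allFin N))

ecc : (m : ℕ) → Adj (suc m) → ℚ
ecc m adj = (+ sum (map (eccV adj) (allFin (suc m)))) / suc m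

-- Vertex 0 is the centre v; the i-th path P_{n_i} occupies vertices
-- off+1, …, off+n_i where off = n₁+⋯+n_{i-1}; vertex off+1 is the end
-- vertex adjacent to the centre.

starEdges : ℕ → List ℕ → List (ℕ × ℕ)
starEdges off []       = []
starEdges off (p ∷ ps) =
  (0 , off + 1) ∷ map (λ j → (off + suc j , off + suc (suc j))) (upTo (p ∸ 1))
  ++ starEdges (off + p) ps

starAdjℕ : List ℕ → ℕ → ℕ → Bool
starAdjℕ ps u v =
  any (λ { (a , b) → ((a ≡ᵇ u) ∧ (b ≡ᵇ v)) ∨ ((a ≡ᵇ v) ∧ (b ≡ᵇ u)) })
      (starEdges 0 ps)

sumV : ∀ {k} → Vec ℕ k → ℕ
sumV xs = sum (toList xs)

starAdj : ∀ {k} (p : Vec ℕ k) → Adj (suc (sumV p))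
starAdj p u v = starAdjℕ (toList p) (toℕ u) (toℕ v)

eccStar : ∀ {k} → Vec ℕ k → ℚ
eccStar p = ecc (sumV p) (starAdj p)

data Nonincreasing : List ℕ → Set where
  ni-[]  : Nonincreasing []
  ni-[x] : ∀ x → Nonincreasing (x ∷ [])
  ni-∷   : ∀ {x y ys} → y ≤ x → Nonincreasing (y ∷ ys) → Nonincreasing (x ∷ y ∷ ys)

data AllPos : List ℕ → Set where
  pos-[] : AllPos []
  pos-∷  : ∀ {x xs} → 1 ≤ x → AllPos xs → AllPos (x ∷ xs)

record _≻_ {k : ℕ} (x y : Vec ℕ k) : Set where
  field
    x-noninc : Nonincreasing (toList x)
    y-noninc : Nonincreasing (toList y)
    prefix   : ∀ j → 1 ≤ j → j < k → sum (take j (toList y)) ≤ sum (take j (toList x))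
    total    : sumV x ≡ sumV y

-- In S(p₁, …, p_k) with p₁ ≥ p₂ ≥ ⋯, graph distance is the tree metric on (branch, depth) coordinates,
-- so a vertex at depth d has eccentricity d + p₁ off the first branch and max(d + p₂, p₁ − d) on it.
-- Summing, 8 Σ ε + 2 [p₁ − p₂ even] + 4 (p₁ − p₂) is a polynomial in p₁, p₂, Σ_{i≥2} pᵢ and Σ_{i≥2} pᵢ².
-- For p ≻ q with leading parts a, b and x, y, and u = a − x, the difference 8 Σ ε(p) − 8 Σ ε(q) equals
-- 2V + 4 (Σ_{i≥2} pᵢ² + u (b + y) − Σ_{i≥2} qᵢ²) − 2 [a − b even] + 2 [x − y even] with V ≥ 0.
-- The middle term is nonnegative because (p₂, p₃, …) with a head start u still majorizes (q₂, q₃, …),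
-- and V = 0 forces a + b = x + y, hence a − b ≡ x − y (mod 2), so the parity terms never win.

module Submission where

open import Defs

-- Polynomial identities in ℕ, proved in ℤ. The anonymous module keeps the integer operators out of
-- scope of the rest of the file, which works with the natural-number ones.
module _ where
  import Data.Nat as ℕ
  import Data.Nat.Properties as ℕ
  open import Data.Nat using (ℕ)
  open import Data.Integer
  open import Data.Integer.Properties
    using (pos-+; pos-*; +-injective; i≡j⇒i-j≡0; i-j≡0⇒i≡j; m-n≡m⊖n; ⊖-≥)
  open import Data.Integer.Tactic.RingSolver using (solve-∀)
  import Data.Rational as ℚ
  open import Data.Rational.Properties using (toℚᵘ-cancel-≤; toℚᵘ-fromℚᵘ)
  import Data.Rational.Unnormalised as ℚᵘ
  import Data.Rational.Unnormalised.Properties as ℚᵘ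
  open import Relation.Binary.PropositionalEquality

  infixl 6 _:+_
  infixl 7 _:*_

  -- Polynomial expressions, evaluated both in ℕ and in ℤ so that identities can be moved between them.
  data Expr (A : Set) : Set where
    var : A → Expr A
    con : ℕ → Expr A
    _:+_ _:*_ : Expr A → Expr A → Expr A

  mapVar : ∀ {A B : Set} → (A → B) → Expr A → Expr B
  mapVar f (var x)   = var (f x)
  mapVar f (con n)   = con n
  mapVar f (e :+ e′) = mapVar f e :+ mapVar f e′
  mapVar f (e :* e′) = mapVar f e :* mapVar f e′

  ⟦_⟧ℕ : Expr ℕ → ℕ
  ⟦ var x ⟧ℕ   = x
  ⟦ con n ⟧ℕ   = n
  ⟦ e :+ e′ ⟧ℕ = ⟦ e ⟧ℕ ℕ.+ ⟦ e′ ⟧ℕ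
  ⟦ e :* e′ ⟧ℕ = ⟦ e ⟧ℕ ℕ.* ⟦ e′ ⟧ℕ

  ⟦_⟧ℤ : Expr ℤ → ℤ
  ⟦ var x ⟧ℤ   = x
  ⟦ con n ⟧ℤ   = + n
  ⟦ e :+ e′ ⟧ℤ = ⟦ e ⟧ℤ + ⟦ e′ ⟧ℤ
  ⟦ e :* e′ ⟧ℤ = ⟦ e ⟧ℤ * ⟦ e′ ⟧ℤ

  +⟦⟧ℕ : ∀ e → + ⟦ e ⟧ℕ ≡ ⟦ mapVar +_ e ⟧ℤ
  +⟦⟧ℕ (var x)   = refl
  +⟦⟧ℕ (con n)   = refl
  +⟦⟧ℕ (e :+ e′) = trans (pos-+ ⟦ e ⟧ℕ ⟦ e′ ⟧ℕ) (cong₂ _+_ (+⟦⟧ℕ e) (+⟦⟧ℕ e′))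
  +⟦⟧ℕ (e :* e′) = trans (pos-* ⟦ e ⟧ℕ ⟦ e′ ⟧ℕ) (cong₂ _*_ (+⟦⟧ℕ e) (+⟦⟧ℕ e′))

  ⟦⟧ℕ-identity⇒ℤ : ∀ e e′ → ⟦ e ⟧ℕ ≡ ⟦ e′ ⟧ℕ →
                   ⟦ mapVar +_ e ⟧ℤ ≡ ⟦ mapVar +_ e′ ⟧ℤ
  ⟦⟧ℕ-identity⇒ℤ e e′ eq = trans (sym (+⟦⟧ℕ e)) (trans (cong +_ eq) (+⟦⟧ℕ e′))

  ⟦⟧ℤ-identity⇒ℕ : ∀ e e′ → ⟦ mapVar +_ e ⟧ℤ ≡ ⟦ mapVar +_ e′ ⟧ℤ →
                   ⟦ e ⟧ℕ ≡ ⟦ e′ ⟧ℕ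
  ⟦⟧ℤ-identity⇒ℕ e e′ eq = +-injective (trans (+⟦⟧ℕ e) (trans eq (sym (+⟦⟧ℕ e′))))

  +[m∸n]≡+m-+n : ∀ {m n} → n ℕ.≤ m → + (m ℕ.∸ n) ≡ + m - + n
  +[m∸n]≡+m-+n {m} {n} n≤m = sym (trans (m-n≡m⊖n m n) (⊖-≥ n≤m))

  +[m+n∸[o+p]]≡+m++n-[+o++p] : ∀ {m n o p} → o ℕ.+ p ℕ.≤ m ℕ.+ n →
                               + (m ℕ.+ n ℕ.∸ (o ℕ.+ p)) ≡ + m + + n - (+ o + + p)
  +[m+n∸[o+p]]≡+m++n-[+o++p] {m} {n} {o} {p} le =
    trans (+[m∸n]≡+m-+n le) (cong₂ _-_ (pos-+ m n) (pos-+ o p))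

  m+n≡o+p⇒+p≡+m++n-+o : ∀ {m n o p} → m ℕ.+ n ≡ o ℕ.+ p → + p ≡ + m + + n - + o
  m+n≡o+p⇒+p≡+m++n-+o {m} {n} {o} {p} eq = begin
    + p                ≡⟨ p≡o+p-o (+ o) (+ p) ⟩
    + o + + p - + o    ≡⟨ cong (_- + o) (trans (sym (pos-+ o p)) (trans (cong +_ (sym eq)) (pos-+ m n))) ⟩
    + m + + n - + o    ∎
    where
    open ≡-Reasoning
    p≡o+p-o : ∀ o p → p ≡ o + p - o
    p≡o+p-o = solve-∀

  -- The value of 8 · Σ ε + 2 · [a − b even] + 4 (a − b) on S(a, b, …), where c = a − b and
  -- P and S are the sum of squares and the sum of (b, …); see eccSum-closedForm.
  closedForm : ∀ {A} → (a b c P S : A) → Expr A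
  closedForm a b c P S = con 8 :* var a :* (var S :+ var b :+ con 1)
                       :+ con 4 :* (var a :+ var S :+ var a :* var a :+ var P) :+ con 2 :* (var c :* var c :+ con 1)

  weighted : ∀ {A} → (f e c : A) → Expr A
  weighted f e c = con 8 :* var f :+ con 2 :* var e :+ con 4 :* var c

  -- Matching the linear relations against refl leaves a single ring identity.
  comparison-identityℤ : ∀ (a b x y s P Q fp fq ep eq : ℕ) {C₁ C₂ Sp Sq U W : ℤ} →
    let A = + a; B = + b; X = + x; Y = + y; S = + s in
    C₁ ≡ A - B → C₂ ≡ X - Y → Sp ≡ B + S → Sq ≡ A + Sp - X → U ≡ A - X → W ≡ A + B - (X + Y) →
    + 8 * + fp + + 2 * + ep + + 4 * C₁ ≡ ⟦ closedForm A B C₁ (+ P) Sp ⟧ℤ →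
    + 8 * + fq + + 2 * + eq + + 4 * C₂ ≡ ⟦ closedForm X Y C₂ (+ Q) Sq ⟧ℤ →
    + 8 * + fp + + 2 * + ep + + 4 * + Q ≡
    + 8 * + fq + + 2 * (+ 4 * (S * U) + W * (A + B + X + Y + + 2 * U + + 2)) + + 4 * + P + + 4 * (U * (B + Y)) + + 2 * + eq
  comparison-identityℤ a b x y s P Q fp fq ep eq refl refl refl refl refl refl hp hq =
    i-j≡0⇒i≡j _ _ (begin
      _ ≡⟨ identity (+ a) (+ b) (+ x) (+ y) (+ s) (+ P) (+ Q) (+ fp) (+ fq) (+ ep) (+ eq) ⟩
      _ ≡⟨ cong₂ _-_ (i≡j⇒i-j≡0 hp) (i≡j⇒i-j≡0 hq) ⟩
      + 0 - + 0 ≡⟨⟩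
      + 0 ∎)
    where
    open ≡-Reasoning
    identity : ∀ A B X Y S P Q Fp Fq Ep Eq →
      + 8 * Fp + + 2 * Ep + + 4 * Q
        - (+ 8 * Fq + + 2 * (+ 4 * (S * (A - X)) + (A + B - (X + Y)) * (A + B + X + Y + + 2 * (A - X) + + 2))
           + + 4 * P + + 4 * ((A - X) * (B + Y)) + + 2 * Eq)
      ≡ (+ 8 * Fp + + 2 * Ep + + 4 * (A - B)
          - (+ 8 * A * ((B + S) + B + + 1) + + 4 * (A + (B + S) + A * A + P) + + 2 * ((A - B) * (A - B) + + 1)))
        - (+ 8 * Fq + + 2 * Eq + + 4 * (X - Y)
          - (+ 8 * X * ((A + (B + S) - X) + Y + + 1) + + 4 * (X + (A + (B + S) - X) + X * X + Q)
             + + 2 * ((X - Y) * (X - Y) + + 1)))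
    identity = solve-∀

  +m/[1+n′]≤+o/[1+n] : ∀ {m o n n′} → n ≡ n′ → m ℕ.≤ o →
                       + m ℚ./ ℕ.suc n′ ℚ.≤ + o ℚ./ ℕ.suc n
  +m/[1+n′]≤+o/[1+n] {m} {o} {n} refl m≤o = toℚᵘ-cancel-≤
    (ℚᵘ.≤-respˡ-≃ (ℚᵘ.≃-sym (toℚᵘ-fromℚᵘ m/[1+n])) (ℚᵘ.≤-respʳ-≃ (ℚᵘ.≃-sym (toℚᵘ-fromℚᵘ o/[1+n]))
      (ℚᵘ.*≤* (subst₂ _≤_ (pos-* m (ℕ.suc n)) (pos-* o (ℕ.suc n)) (+≤+ (ℕ.*-monoˡ-≤ (ℕ.suc n) m≤o))))))
    where
    m/[1+n] = ℚᵘ.mkℚᵘ (+ m) n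
    o/[1+n] = ℚᵘ.mkℚᵘ (+ o) n

open import Data.Bool using (Bool; true; false; T; _∧_)
open import Data.Bool.Properties using (T-∧; T-∨)
open import Data.Empty using (⊥-elim)
open import Data.Fin as Fin using (Fin; toℕ; fromℕ<)
open import Data.Fin.Properties using (toℕ-fromℕ<; toℕ<n)
open import Data.Integer.Properties using (pos-+)
open import Data.List using (List; []; _∷_; map; take; length; upTo; allFin; tabulate)
open import Data.List.Membership.Propositional using (_∈_; find; lose)
open import Data.List.Membership.Propositional.Properties
  using (∈-map⁺; ∈-map⁻; ∈-++⁺ˡ; ∈-++⁺ʳ; ∈-++⁻; ∈-upTo⁺; ∈-upTo⁻; ∈-allFin)
open import Data.List.Properties using (map-tabulate; take-all)
open import Data.List.Relation.Unary.Any using (here; there)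
open import Data.List.Relation.Unary.Any.Properties using (any⁺; any⁻)
open import Data.Nat hiding (_≥_)
open import Data.Nat.ListAction using (sum)
open import Data.Nat.Properties
open import Data.Nat.Tactic.RingSolver using (solve-∀)
open import Data.Product using (_×_; _,_; proj₁; proj₂; ∃-syntax)
open import Data.Rational using (_≥_)
open import Data.Sum using (_⊎_; inj₁; inj₂)
open import Data.Vec using (Vec; toList; _∷_)
open import Data.Vec.Properties using (length-toList)
open import Function using (_∘_; id)
open import Function.Bundles using (Equivalence)
open import Relation.Binary.Definitions using (tri<; tri≈; tri>)
open import Relation.Binary.PropositionalEquality
open import Relation.Nullary using (yes; no)

-- Coordinates and the tree metric

-- A vertex is located as (branch, depth), with branches numbered from 0 and depth 0 meaning the
-- centre, whatever the branch.

lookup₀ : List ℕ → ℕ → ℕ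
lookup₀ []       _       = 0
lookup₀ (p ∷ ps) zero    = p
lookup₀ (p ∷ ps) (suc i) = lookup₀ ps i

offset : List ℕ → ℕ → ℕ
offset ps i = sum (take i ps)

locate : List ℕ → ℕ → ℕ × ℕ
locate []       y = (0 , 0)
locate (p ∷ ps) y with y <? p
... | yes _ = (0 , suc y)
... | no  _ = (suc (proj₁ (locate ps (y ∸ p))) , proj₂ (locate ps (y ∸ p)))

coord : List ℕ → ℕ → ℕ × ℕ
coord ps zero    = (0 , 0)
coord ps (suc y) = locate ps y

coord-onBranch : ∀ ps i {d} → d < lookup₀ ps i → coord ps (suc (offset ps i + d)) ≡ (i , suc d)
coord-onBranch (p ∷ ps) zero {d} d<p with d <? p
... | yes _   = refl
... | no  d≮p = ⊥-elim (d≮p d<p)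
coord-onBranch (p ∷ ps) (suc i) {d} d<pᵢ with p + offset ps i + d <? p
... | yes lt = ⊥-elim (m+n≮m p _ (subst (_< p) (+-assoc p (offset ps i) d) lt))
... | no _ rewrite +-assoc p (offset ps i) d | m+n∸m≡n p (offset ps i + d)
                 | coord-onBranch ps i d<pᵢ = refl

offset+<sum : ∀ ps i {d} → d < lookup₀ ps i → offset ps i + d < sum ps
offset+<sum (p ∷ ps) zero    d<p  = ≤-trans d<p (m≤m+n p _)
offset+<sum (p ∷ ps) (suc i) {d} d<pᵢ rewrite +-assoc p (offset ps i) d =
  +-monoʳ-< p (offset+<sum ps i d<pᵢ)

branchDecomposition : ∀ ps {y} → y < sum ps →
                      ∃[ i ] ∃[ d ] (d < lookup₀ ps i × y ≡ offset ps i + d)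
branchDecomposition (p ∷ ps) {y} y<Σ with y <? p
... | yes y<p = 0 , y , y<p , refl
... | no  y≮p
  with branchDecomposition ps (subst (y ∸ p <_) (m+n∸m≡n p (sum ps)) (∸-monoˡ-< y<Σ (≮⇒≥ y≮p)))
...   | i , d , l , eq = suc i , d , l , (begin
  y                      ≡⟨ m+[n∸m]≡n (≮⇒≥ y≮p) ⟨
  p + (y ∸ p)            ≡⟨ cong (p +_) eq ⟩
  p + (offset ps i + d)  ≡⟨ +-assoc p _ d ⟨
  p + offset ps i + d    ∎)
  where open ≡-Reasoning

data VertexView (ps : List ℕ) : ℕ → Set where
  centre   : VertexView ps 0
  onBranch : ∀ i {d} → d < lookup₀ ps i → VertexView ps (suc (offset ps i + d))

vertexView : ∀ ps {x} → x < suc (sum ps) → VertexView ps x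
vertexView ps {zero}  _ = centre
vertexView ps {suc y} (s≤s y<Σ) with branchDecomposition ps y<Σ
... | i , d , l , refl = onBranch i l

treeDist : ℕ × ℕ → ℕ × ℕ → ℕ
treeDist (i , d) (j , e) with i ≟ j
... | yes _ = ∣ d - e ∣
... | no  _ = d + e

treeDist-sameBranch : ∀ i d e → treeDist (i , d) (i , e) ≡ ∣ d - e ∣
treeDist-sameBranch i d e with i ≟ i
... | yes _  = refl
... | no i≢i = ⊥-elim (i≢i refl)

treeDist-otherBranch : ∀ {i j} d e → i ≢ j → treeDist (i , d) (j , e) ≡ d + e
treeDist-otherBranch {i} {j} d e i≢j with i ≟ j
... | yes i≡j = ⊥-elim (i≢j i≡j)
... | no  _   = refl

treeDist-centreʳ : ∀ i d j → treeDist (i , d) (j , 0) ≡ d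
treeDist-centreʳ i d j with i ≟ j
... | yes _ = ∣-∣-identityʳ d
... | no  _ = +-identityʳ d

treeDist-centreˡ : ∀ i d j → treeDist (j , 0) (i , d) ≡ d
treeDist-centreˡ i d j with j ≟ i
... | yes _ = refl
... | no  _ = refl

treeDist-comm : ∀ x y → treeDist x y ≡ treeDist y x
treeDist-comm (i , d) (j , e) with i ≟ j | j ≟ i
... | yes _   | yes _   = ∣-∣-comm d e
... | yes i≡j | no  j≢i = ⊥-elim (j≢i (sym i≡j))
... | no  i≢j | yes j≡i = ⊥-elim (i≢j (sym j≡i))
... | no  _   | no  _   = +-comm d e

treeDist-self : ∀ x → treeDist x x ≡ 0
treeDist-self (i , d) = trans (treeDist-sameBranch i d d) (∣n-n∣≡0 d)

treeDist≤depth+depth : ∀ x y → treeDist x y ≤ proj₂ x + proj₂ y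
treeDist≤depth+depth (i , d) (j , e) with i ≟ j
... | yes _ = ≤-trans (∣m-n∣≤m⊔n d e) (m⊔n≤m+n d e)
... | no  _ = ≤-refl

private
  d+f≤d+e+[e+f] : ∀ d e f → d + f ≤ d + e + (e + f)
  d+f≤d+e+[e+f] d e f = ≤-trans (+-monoʳ-≤ d (≤-trans (m≤n+m f e) (m≤n+m (e + f) e)))
                                (≤-reflexive (sym (+-assoc d e (e + f))))

treeDist-triangle : ∀ x y z → treeDist x z ≤ treeDist x y + treeDist y z
treeDist-triangle (i , d) (j , e) (l , f) with i ≟ j | j ≟ l | i ≟ l
... | yes refl | yes refl | yes _    = ∣-∣-triangle d e f
... | yes refl | yes refl | no  i≢i = ⊥-elim (i≢i refl)
... | yes refl | no  j≢j | yes refl = ⊥-elim (j≢j refl)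
... | no  i≢i | yes refl | yes refl = ⊥-elim (i≢i refl)
... | yes refl | no  _ | no  _ = begin
  d + f             ≤⟨ +-monoˡ-≤ f (m≤∣m-n∣+n d e) ⟩
  ∣ d - e ∣ + e + f ≡⟨ +-assoc ∣ d - e ∣ e f ⟩
  ∣ d - e ∣ + (e + f) ∎
  where open ≤-Reasoning
... | no  _ | yes refl | no  _ = begin
  d + f             ≤⟨ +-monoʳ-≤ d (m≤n+∣n-m∣ f e) ⟩
  d + (e + ∣ e - f ∣) ≡⟨ +-assoc d e ∣ e - f ∣ ⟨
  d + e + ∣ e - f ∣ ∎
  where open ≤-Reasoning
... | no  _ | no  _ | yes refl = ≤-trans (≤-trans (∣m-n∣≤m⊔n d f) (m⊔n≤m+n d f)) (d+f≤d+e+[e+f] d e f)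
... | no  _ | no  _ | no  _    = d+f≤d+e+[e+f] d e f

data StarEdge (off : ℕ) (ps : List ℕ) : ℕ → ℕ → Set where
  spoke : ∀ i → i < length ps → StarEdge off ps 0 (off + suc (offset ps i))
  along : ∀ i {d} → suc d < lookup₀ ps i →
          StarEdge off ps (off + suc (offset ps i + d)) (off + suc (offset ps i + suc d))

private
  +-suc-shift : ∀ off p z → off + p + suc z ≡ off + suc (p + z)
  +-suc-shift off p z = trans (+-assoc off p (suc z)) (cong (off +_) (+-suc p z))

  +-suc-shift₃ : ∀ off p z d → off + p + suc (z + d) ≡ off + suc (p + z + d)
  +-suc-shift₃ off p z d = trans (+-suc-shift off p (z + d)) (cong (λ t → off + suc t) (sym (+-assoc p z d)))

StarEdge-cons : ∀ {off p ps a b} → StarEdge (off + p) ps a b → StarEdge off (p ∷ ps) a b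
StarEdge-cons {off} {p} {ps} (spoke i i<k) =
  subst (StarEdge off (p ∷ ps) 0) (sym (+-suc-shift off p (offset ps i))) (spoke (suc i) (s≤s i<k))
StarEdge-cons {off} {p} {ps} (along i {d} lt) =
  subst₂ (StarEdge off (p ∷ ps)) (sym (+-suc-shift₃ off p (offset ps i) d))
         (sym (+-suc-shift₃ off p (offset ps i) (suc d))) (along (suc i) lt)

∈-starEdges⁻ : ∀ off ps {a b} → (a , b) ∈ starEdges off ps → StarEdge off ps a b
∈-starEdges⁻ off (p ∷ ps) (here refl) = spoke 0 (s≤s z≤n)
∈-starEdges⁻ off (p ∷ ps) (there ab∈) with ∈-++⁻ (map _ (upTo (p ∸ 1))) ab∈
... | inj₂ ab∈rest = StarEdge-cons (∈-starEdges⁻ (off + p) ps ab∈rest)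
... | inj₁ ab∈path with ∈-map⁻ (λ j → (off + suc j , off + suc (suc j))) ab∈path
...   | j , j∈ , refl = along 0 (<∸1⇒suc< p (∈-upTo⁻ j∈))
  where
  <∸1⇒suc< : ∀ {j} p → j < p ∸ 1 → suc j < p
  <∸1⇒suc< (suc p) j<p = s≤s j<p

∈-starEdges⁺ : ∀ off ps {a b} → StarEdge off ps a b → (a , b) ∈ starEdges off ps
∈-starEdges⁺ off (p ∷ ps) (spoke zero _) = here refl
∈-starEdges⁺ off (p ∷ ps) (spoke (suc i) (s≤s i<k)) =
  there (∈-++⁺ʳ _ (subst (λ b → (0 , b) ∈ starEdges (off + p) ps) (+-suc-shift off p (offset ps i))
                         (∈-starEdges⁺ (off + p) ps (spoke i i<k))))
∈-starEdges⁺ off (suc p ∷ ps) (along zero (s≤s lt)) =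
  there (∈-++⁺ˡ (∈-map⁺ (λ j → (off + suc j , off + suc (suc j))) (∈-upTo⁺ lt)))
∈-starEdges⁺ off (p ∷ ps) (along (suc i) {d} lt) =
  there (∈-++⁺ʳ _ (subst₂ (λ a b → (a , b) ∈ starEdges (off + p) ps)
                          (+-suc-shift₃ off p (offset ps i) d) (+-suc-shift₃ off p (offset ps i) (suc d))
                          (∈-starEdges⁺ (off + p) ps (along i lt))))

Adjacent : List ℕ → ℕ → ℕ → Set
Adjacent ps u v = StarEdge 0 ps u v ⊎ StarEdge 0 ps v u

private
  T-≡ᵇ∧≡ᵇ : ∀ a b u v → T ((a ≡ᵇ u) ∧ (b ≡ᵇ v)) → (a , b) ≡ (u , v)
  T-≡ᵇ∧≡ᵇ a b u v t with a≡u , b≡v ← Equivalence.to T-∧ t = cong₂ _,_ (≡ᵇ⇒≡ a u a≡u) (≡ᵇ⇒≡ b v b≡v)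

T-starAdjℕ⇒Adjacent : ∀ ps {u v} → T (starAdjℕ ps u v) → Adjacent ps u v
T-starAdjℕ⇒Adjacent ps {u} {v} t with find (any⁻ _ (starEdges 0 ps) t)
... | (a , b) , ab∈ , t′ with Equivalence.to T-∨ t′
...   | inj₁ t₁ with refl ← T-≡ᵇ∧≡ᵇ a b u v t₁ = inj₁ (∈-starEdges⁻ 0 ps ab∈)
...   | inj₂ t₂ with refl ← T-≡ᵇ∧≡ᵇ a b v u t₂ = inj₂ (∈-starEdges⁻ 0 ps ab∈)

Adjacent⇒T-starAdjℕ : ∀ ps {u v} → Adjacent ps u v → T (starAdjℕ ps u v)
Adjacent⇒T-starAdjℕ ps {u} {v} (inj₁ uv) = any⁺ _ (lose (∈-starEdges⁺ 0 ps uv)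
  (Equivalence.from T-∨ (inj₁ (Equivalence.from T-∧ (≡⇒≡ᵇ u u refl , ≡⇒≡ᵇ v v refl)))))
Adjacent⇒T-starAdjℕ ps {u} {v} (inj₂ vu) = any⁺ _ (lose (∈-starEdges⁺ 0 ps vu)
  (Equivalence.from T-∨ (inj₂ (Equivalence.from T-∧ (≡⇒≡ᵇ v v refl , ≡⇒≡ᵇ u u refl)))))

starDist : List ℕ → ℕ → ℕ → ℕ
starDist ps x y = treeDist (coord ps x) (coord ps y)

lookup₀-pos : ∀ {ps} i → AllPos ps → i < length ps → 0 < lookup₀ ps i
lookup₀-pos zero    (pos-∷ 0<p _)  _         = 0<p
lookup₀-pos (suc i) (pos-∷ _ pos) (s≤s i<k) = lookup₀-pos i pos i<k

<lookup₀⇒<length : ∀ ps i {d} → d < lookup₀ ps i → i < length ps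
<lookup₀⇒<length (p ∷ ps) zero    _ = s≤s z≤n
<lookup₀⇒<length (p ∷ ps) (suc i) l = s≤s (<lookup₀⇒<length ps i l)

coord-firstOnBranch : ∀ ps i → 0 < lookup₀ ps i → coord ps (suc (offset ps i)) ≡ (i , 1)
coord-firstOnBranch ps i 0<pᵢ =
  trans (cong (λ t → coord ps (suc t)) (sym (+-identityʳ (offset ps i)))) (coord-onBranch ps i 0<pᵢ)

InStar : List ℕ → ℕ × ℕ → Set
InStar ps (i , d) = d ≤ lookup₀ ps i

coord-InStar : ∀ ps {x} → x < suc (sum ps) → InStar ps (coord ps x)
coord-InStar ps x< with vertexView ps x<
... | centre       = z≤n
... | onBranch i l rewrite coord-onBranch ps i l = l

private
  ∣n-suc[n]∣≡1 : ∀ n → ∣ n - suc n ∣ ≡ 1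
  ∣n-suc[n]∣≡1 zero    = refl
  ∣n-suc[n]∣≡1 (suc n) = ∣n-suc[n]∣≡1 n

StarEdge-starDist : ∀ {ps a b} → AllPos ps → StarEdge 0 ps a b → starDist ps a b ≡ 1
StarEdge-starDist {ps} pos (spoke i i<k)
  rewrite coord-firstOnBranch ps i (lookup₀-pos i pos i<k) = treeDist-centreˡ i 1 0
StarEdge-starDist {ps} pos (along i {d} lt)
  rewrite coord-onBranch ps i (<-trans (n<1+n d) lt) | coord-onBranch ps i lt
        | treeDist-sameBranch i (suc d) (suc (suc d)) = ∣n-suc[n]∣≡1 d

Adjacent-starDist : ∀ {ps u v} → AllPos ps → Adjacent ps u v → starDist ps u v ≡ 1
Adjacent-starDist pos (inj₁ uv) = StarEdge-starDist pos uv
Adjacent-starDist {ps} {u} {v} pos (inj₂ vu) =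
  trans (treeDist-comm (coord ps u) (coord ps v)) (StarEdge-starDist pos vu)

starDist≡0⇒≡ : ∀ ps {x y} → x < suc (sum ps) → y < suc (sum ps) → starDist ps x y ≡ 0 → x ≡ y
starDist≡0⇒≡ ps x< y< eq with vertexView ps x< | vertexView ps y<
... | centre | centre = refl
... | centre | onBranch j {e} l
  rewrite coord-onBranch ps j l | treeDist-centreˡ j (suc e) 0 with () ← eq
... | onBranch i {d} l | centre
  rewrite coord-onBranch ps i l | treeDist-centreʳ i (suc d) 0 with () ← eq
... | onBranch i {d} l | onBranch j {e} l′
  rewrite coord-onBranch ps i l | coord-onBranch ps j l′ with i ≟ j
...   | yes refl with refl ← ∣m-n∣≡0⇒m≡n {d} {e} eq = refl
...   | no  _    with () ← eq

NeighbourAt : List ℕ → ℕ → (ℕ × ℕ → Set) → Set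
NeighbourAt ps v P = ∃[ w ] (w < suc (sum ps) × Adjacent ps w v × P (coord ps w))

-- The parent is only pinned down through treeDist: at depth 0 it is the centre, which treeDist cannot
-- tell apart from (j , 0).
parent : ∀ ps j {e} → e < lookup₀ ps j →
         NeighbourAt ps (suc (offset ps j + e)) (λ x → ∀ c → treeDist c x ≡ treeDist c (j , e))
parent ps j {zero} l =
  0 , s≤s z≤n ,
  inj₁ (subst (StarEdge 0 ps 0) (cong suc (sym (+-identityʳ (offset ps j)))) (spoke j (<lookup₀⇒<length ps j l))) ,
  λ (i , d) → trans (treeDist-centreʳ i d 0) (sym (treeDist-centreʳ i d j))
parent ps j {suc e} l =
  suc (offset ps j + e) , s≤s (offset+<sum ps j e<pⱼ) , inj₁ (along j l) ,
  λ c → cong (treeDist c) (coord-onBranch ps j e<pⱼ)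
  where e<pⱼ = <-trans (n<1+n e) l

child : ∀ ps j {e} → suc e < lookup₀ ps j → NeighbourAt ps (suc (offset ps j + e)) (_≡ (j , suc (suc e)))
child ps j l = suc (offset ps j + suc _) , s≤s (offset+<sum ps j l) , inj₂ (along j l) , coord-onBranch ps j l

childOfCentre : ∀ ps i → 0 < lookup₀ ps i → NeighbourAt ps 0 (_≡ (i , 1))
childOfCentre ps i 0<pᵢ =
  suc (offset ps i) , s≤s (subst (_< sum ps) (+-identityʳ (offset ps i)) (offset+<sum ps i 0<pᵢ)) ,
  inj₂ (spoke i (<lookup₀⇒<length ps i 0<pᵢ)) , coord-firstOnBranch ps i 0<pᵢ

private
  ∣m-suc[n]∣≡suc∣m-n∣ : ∀ {m n} → m ≤ n → ∣ m - suc n ∣ ≡ suc ∣ m - n ∣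
  ∣m-suc[n]∣≡suc∣m-n∣ {zero}  _         = refl
  ∣m-suc[n]∣≡suc∣m-n∣ {suc m} (s≤s m≤n) = ∣m-suc[n]∣≡suc∣m-n∣ m≤n

  ∣m-n∣≡suc∣m-suc[n]∣ : ∀ {m n} → n < m → ∣ m - n ∣ ≡ suc ∣ m - suc n ∣
  ∣m-n∣≡suc∣m-suc[n]∣ {suc m} {zero}  _         = cong suc (sym (∣-∣-identityʳ m))
  ∣m-n∣≡suc∣m-suc[n]∣ {suc m} {suc n} (s≤s n<m) = ∣m-n∣≡suc∣m-suc[n]∣ n<m

closerNeighbour : ∀ ps c → InStar ps c → ∀ {v m} → v < suc (sum ps) →
                  treeDist c (coord ps v) ≡ suc m → NeighbourAt ps v (λ x → treeDist c x ≡ m)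
closerNeighbour ps (i , d) d≤pᵢ v< eq with vertexView ps v<
... | centre with refl ← trans (sym (treeDist-centreʳ i d 0)) eq
  with w , w< , adj , at ← childOfCentre ps i (≤-trans (s≤s z≤n) d≤pᵢ) =
  w , w< , adj , trans (cong (treeDist (i , _)) at) (trans (treeDist-sameBranch i _ 1) (∣-∣-identityʳ _))
closerNeighbour ps (i , d) d≤pᵢ v< eq | onBranch j {e} l
  rewrite coord-onBranch ps j l with i ≟ j
... | no i≢j with w , w< , adj , at ← parent ps j l =
  w , w< , adj , trans (at (i , d)) (trans (treeDist-otherBranch d e i≢j)
                       (suc-injective (trans (sym (+-suc d e)) eq)))
... | yes refl with <-cmp d (suc e)
...   | tri< (s≤s d≤e) _ _ with w , w< , adj , at ← parent ps j l =
  w , w< , adj , trans (at (j , d)) (trans (treeDist-sameBranch j d e)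
                       (suc-injective (trans (sym (∣m-suc[n]∣≡suc∣m-n∣ d≤e)) eq)))
...   | tri≈ _ refl _ with () ← trans (sym (∣n-n∣≡0 d)) eq
...   | tri> _ _ e<d with w , w< , adj , at ← child ps j (<-≤-trans e<d d≤pᵢ) =
  w , w< , adj , trans (cong (treeDist (j , d)) at) (trans (treeDist-sameBranch j d (suc (suc e)))
                       (suc-injective (trans (sym (∣m-n∣≡suc∣m-suc[n]∣ e<d)) eq)))

-- Graph distance

starAdjList : (ps : List ℕ) → Adj (suc (sum ps))
starAdjList ps u v = starAdjℕ ps (toℕ u) (toℕ v)

reach-sound : ∀ {ps} → AllPos ps → ∀ m (u v : Fin (suc (sum ps))) →
              T (reach (starAdjList ps) m u v) → starDist ps (toℕ u) (toℕ v) ≤ m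
reach-sound {ps} pos zero u v t rewrite ≡ᵇ⇒≡ (toℕ u) (toℕ v) t | treeDist-self (coord ps (toℕ v)) = z≤n
reach-sound {ps} pos (suc m) u v t with Equivalence.to T-∨ t
... | inj₁ t₁ = m≤n⇒m≤1+n (reach-sound pos m u v t₁)
... | inj₂ t₂ with find (any⁻ _ (allFin (suc (sum ps))) t₂)
...   | w , _ , t′ with Equivalence.to T-∧ t′
...     | u⇝w , w~v = begin
  starDist ps (toℕ u) (toℕ v)
    ≤⟨ treeDist-triangle (coord ps (toℕ u)) (coord ps (toℕ w)) _ ⟩
  starDist ps (toℕ u) (toℕ w) + starDist ps (toℕ w) (toℕ v)
    ≤⟨ +-monoˡ-≤ _ (reach-sound pos m u w u⇝w) ⟩
  m + starDist ps (toℕ w) (toℕ v)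
    ≡⟨ cong (m +_) (Adjacent-starDist pos (T-starAdjℕ⇒Adjacent ps w~v)) ⟩
  m + 1
    ≡⟨ +-comm m 1 ⟩
  suc m ∎
  where open ≤-Reasoning

reach-complete : ∀ {ps} → AllPos ps → ∀ m (u v : Fin (suc (sum ps))) →
                 starDist ps (toℕ u) (toℕ v) ≤ m → T (reach (starAdjList ps) m u v)
reach-complete {ps} pos zero u v d≤0 =
  ≡⇒≡ᵇ (toℕ u) (toℕ v) (starDist≡0⇒≡ ps (toℕ<n u) (toℕ<n v) (n≤0⇒n≡0 d≤0))
reach-complete {ps} pos (suc m) u v d≤1+m with starDist ps (toℕ u) (toℕ v) ≤? m
... | yes d≤m = Equivalence.from T-∨ (inj₁ (reach-complete pos m u v d≤m))
... | no  d≰m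
  with w , w< , w~v , dist≡m ← closerNeighbour ps (coord ps (toℕ u)) (coord-InStar ps (toℕ<n u)) (toℕ<n v)
                                                (≤-antisym d≤1+m (≰⇒> d≰m)) =
  Equivalence.from (T-∨ {reach (starAdjList ps) m u v}) (inj₂ (any⁺ _ (lose (∈-allFin w′) u⇝w′~v)))
  where
  w′ = fromℕ< w<
  toℕw′≡w : w ≡ toℕ w′
  toℕw′≡w = sym (toℕ-fromℕ< w<)
  u⇝w′~v : T (reach (starAdjList ps) m u w′ ∧ starAdjList ps w′ v)
  u⇝w′~v = Equivalence.from T-∧
    ( reach-complete pos m u w′ (≤-reflexive (subst (λ x → starDist ps (toℕ u) x ≡ m) toℕw′≡w dist≡m))
    , Adjacent⇒T-starAdjℕ ps (subst (λ x → Adjacent ps x (toℕ v)) toℕw′≡w w~v))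

firstTrue-threshold : ∀ (f : ℕ → Bool) {c} → (∀ m → T (f m) → c ≤ m) → (∀ m → c ≤ m → T (f m)) →
                      ∀ fuel i → i ≤ c → c ≤ i + fuel → firstTrue f fuel i ≡ c
firstTrue-threshold f sound complete zero i i≤c c≤i+0 = ≤-antisym i≤c (subst (_ ≤_) (+-identityʳ i) c≤i+0)
firstTrue-threshold f {c} sound complete (suc fuel) i i≤c c≤i+1+fuel with f i | sound i | complete i
... | true  | c≤i | _ = ≤-antisym i≤c (c≤i _)
... | false | _ | i≱c with i ≟ c
...   | yes refl = ⊥-elim (i≱c ≤-refl)
...   | no  i≢c  = firstTrue-threshold f sound complete fuel (suc i) (≤∧≢⇒< i≤c i≢c)
                     (subst (c ≤_) (+-suc i fuel) c≤i+1+fuel)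

dist-starAdjList-bounded : ∀ {ps} → AllPos ps → (u v : Fin (suc (sum ps))) →
                   starDist ps (toℕ u) (toℕ v) ≤ suc (sum ps) →
                   dist (starAdjList ps) u v ≡ starDist ps (toℕ u) (toℕ v)
dist-starAdjList-bounded {ps} pos u v d≤N = firstTrue-threshold (λ m → reach (starAdjList ps) m u v)
  (λ m → reach-sound pos m u v) (λ m → reach-complete pos m u v) (suc (sum ps)) 0 z≤n d≤N

-- Eccentricities

branchEnd : ∀ ps i → 0 < lookup₀ ps i → ∃[ u ] (u < suc (sum ps) × coord ps u ≡ (i , lookup₀ ps i))
branchEnd ps i 0<pᵢ = suc (offset ps i + pred pᵢ) , s≤s (offset+<sum ps i pred<) ,
                      trans (coord-onBranch ps i pred<) (cong (i ,_) suc-pred-pᵢ)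
  where
  pᵢ = lookup₀ ps i
  suc-pred-pᵢ : suc (pred pᵢ) ≡ pᵢ
  suc-pred-pᵢ = suc-pred pᵢ {{>-nonZero 0<pᵢ}}
  pred< : pred pᵢ < pᵢ
  pred< = ≤-reflexive suc-pred-pᵢ

Nonincreasing-tail : ∀ {p ps} → Nonincreasing (p ∷ ps) → Nonincreasing ps
Nonincreasing-tail (ni-[x] _)  = ni-[]
Nonincreasing-tail (ni-∷ _ ni) = ni

lookup₀≤head : ∀ {p ps} → Nonincreasing (p ∷ ps) → ∀ j → lookup₀ (p ∷ ps) j ≤ p
lookup₀≤head _             zero    = ≤-refl
lookup₀≤head (ni-[x] _)    (suc j) = z≤n
lookup₀≤head (ni-∷ q≤p ni) (suc j) = ≤-trans (lookup₀≤head ni j) q≤p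

lookup₀≤sum : ∀ ps j → lookup₀ ps j ≤ sum ps
lookup₀≤sum []       j       = z≤n
lookup₀≤sum (p ∷ ps) zero    = m≤m+n p _
lookup₀≤sum (p ∷ ps) (suc j) = ≤-trans (lookup₀≤sum ps j) (m≤n+m _ p)

maxL-map-≡ : ∀ {A : Set} (g : A → ℕ) {xs x c} → (∀ y → g y ≤ c) → x ∈ xs → g x ≡ c →
             maxL (map g xs) ≡ c
maxL-map-≡ g {xs} {x} {c} g≤c x∈xs gx≡c = ≤-antisym (maxL≤ xs) (≤maxL x∈xs)
  where
  maxL≤ : ∀ ys → maxL (map g ys) ≤ c
  maxL≤ []       = z≤n
  maxL≤ (y ∷ ys) = ⊔-lub (g≤c y) (maxL≤ ys)
  ≤maxL : ∀ {ys} → x ∈ ys → c ≤ maxL (map g ys)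
  ≤maxL {y ∷ _} (here refl) = ≤-trans (≤-reflexive (sym gx≡c)) (m≤m⊔n (g y) _)
  ≤maxL {y ∷ _} (there x∈)  = ≤-trans (≤maxL x∈) (m≤n⊔m (g y) _)

-- The eccentricity of the point at depth d on branch i of S(a, b, …), a ≥ b ≥ …: the farthest vertex
-- is the end of branch 0, except on branch 0 itself, where it may be the end of branch 1.
starEcc : ℕ → ℕ → ℕ × ℕ → ℕ
starEcc a b (zero  , d) = (d + b) ⊔ (a ∸ d)
starEcc a b (suc _ , d) = d + a

module _ {a b rest} (ni : Nonincreasing (a ∷ b ∷ rest)) (pos : AllPos (a ∷ b ∷ rest)) where

  private
    ps : List ℕ
    ps = a ∷ b ∷ rest
    ni′ : Nonincreasing (b ∷ rest)
    ni′ = Nonincreasing-tail ni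
    0<a : 0 < a
    0<a = lookup₀-pos 0 pos (s≤s z≤n)
    0<b : 0 < b
    0<b = lookup₀-pos 1 pos (s≤s (s≤s z≤n))

  treeDist≤starEcc : ∀ c c′ → InStar ps c → InStar ps c′ → treeDist c c′ ≤ starEcc a b c′
  treeDist≤starEcc (j , e) (suc i , d) e≤ _ = begin
    treeDist (j , e) (suc i , d) ≤⟨ treeDist≤depth+depth (j , e) (suc i , d) ⟩
    e + d                        ≤⟨ +-monoˡ-≤ d (≤-trans e≤ (lookup₀≤head ni j)) ⟩
    a + d                        ≡⟨ +-comm a d ⟩
    d + a                        ∎
    where open ≤-Reasoning
  treeDist≤starEcc (zero , e) (zero , d) e≤a _ rewrite treeDist-sameBranch 0 e d with ∣m-n∣≡[m∸n]∨[n∸m] e d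
  ... | inj₁ eq rewrite eq = ≤-trans (∸-monoˡ-≤ d e≤a) (m≤n⊔m (d + b) (a ∸ d))
  ... | inj₂ eq rewrite eq = ≤-trans (m∸n≤m d e) (≤-trans (m≤m+n d b) (m≤m⊔n (d + b) (a ∸ d)))
  treeDist≤starEcc (suc j , e) (zero , d) e≤ _ rewrite treeDist-otherBranch {suc j} {0} e d (λ ()) = begin
    e + d             ≤⟨ +-monoˡ-≤ d (≤-trans e≤ (lookup₀≤head ni′ j)) ⟩
    b + d             ≡⟨ +-comm b d ⟩
    d + b             ≤⟨ m≤m⊔n (d + b) (a ∸ d) ⟩
    (d + b) ⊔ (a ∸ d) ∎
    where open ≤-Reasoning

  starEcc≤sum : ∀ c → InStar ps c → starEcc a b c ≤ sum ps
  starEcc≤sum (zero , d) d≤a = ⊔-lub (≤-trans (+-monoˡ-≤ b d≤a) (+-monoʳ-≤ a (m≤m+n b (sum rest))))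
                                     (≤-trans (m∸n≤m a d) (m≤m+n a _))
  starEcc≤sum (suc i , d) d≤ = begin
    d + a              ≤⟨ +-monoˡ-≤ a (≤-trans d≤ (lookup₀≤sum (b ∷ rest) i)) ⟩
    sum (b ∷ rest) + a ≡⟨ +-comm (sum (b ∷ rest)) a ⟩
    sum ps             ∎
    where open ≤-Reasoning

  starEcc-attained : ∀ c → InStar ps c → ∃[ u ] (u < suc (sum ps) × treeDist (coord ps u) c ≡ starEcc a b c)
  starEcc-attained (suc i , d) _ with u , u< , u-end ← branchEnd ps 0 0<a =
    u , u< , trans (cong (λ x → treeDist x (suc i , d)) u-end)
                   (trans (treeDist-otherBranch {0} {suc i} a d (λ ())) (+-comm a d))
  starEcc-attained (zero , d) d≤a with (a ∸ d) ≤? (d + b)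
  ... | yes a∸d≤d+b with u , u< , u-end ← branchEnd ps 1 0<b =
    u , u< , trans (cong (λ x → treeDist x (0 , d)) u-end)
                   (trans (treeDist-otherBranch {1} {0} b d (λ ()))
                          (trans (+-comm b d) (sym (m≥n⇒m⊔n≡m a∸d≤d+b))))
  ... | no  a∸d≰d+b with u , u< , u-end ← branchEnd ps 0 0<a =
    u , u< , trans (cong (λ x → treeDist x (0 , d)) u-end)
                   (trans (treeDist-sameBranch 0 a d)
                          (trans (∣-∣-comm a d) (trans (m≤n⇒∣m-n∣≡n∸m d≤a)
                                 (sym (m≤n⇒m⊔n≡n (<⇒≤ (≰⇒> a∸d≰d+b)))))))

  private
    coord-InStar′ : (u : Fin (suc (sum ps))) → InStar ps (coord ps (toℕ u))
    coord-InStar′ u = coord-InStar ps (toℕ<n u)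

  dist-starAdjList : ∀ u v → dist (starAdjList ps) u v ≡ starDist ps (toℕ u) (toℕ v)
  dist-starAdjList u v = dist-starAdjList-bounded pos u v (m≤n⇒m≤1+n (begin
    starDist ps (toℕ u) (toℕ v)
      ≤⟨ treeDist≤starEcc (coord ps (toℕ u)) (coord ps (toℕ v)) (coord-InStar′ u) (coord-InStar′ v) ⟩
    starEcc a b (coord ps (toℕ v))
      ≤⟨ starEcc≤sum (coord ps (toℕ v)) (coord-InStar′ v) ⟩
    sum ps ∎))
    where open ≤-Reasoning

  eccV-starAdjList : ∀ v → eccV (starAdjList ps) v ≡ starEcc a b (coord ps (toℕ v))
  eccV-starAdjList v with starEcc-attained (coord ps (toℕ v)) (coord-InStar′ v)
  ... | u , u< , u-far = maxL-map-≡ (λ w → dist (starAdjList ps) w v) dist≤ecc (∈-allFin (fromℕ< u<)) (begin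
    dist (starAdjList ps) (fromℕ< u<) v      ≡⟨ dist-starAdjList (fromℕ< u<) v ⟩
    starDist ps (toℕ (fromℕ< u<)) (toℕ v)    ≡⟨ cong (λ x → starDist ps x (toℕ v)) (toℕ-fromℕ< u<) ⟩
    starDist ps u (toℕ v)                    ≡⟨ u-far ⟩
    starEcc a b (coord ps (toℕ v))           ∎)
    where
    open ≡-Reasoning
    dist≤ecc : ∀ w → dist (starAdjList ps) w v ≤ starEcc a b (coord ps (toℕ v))
    dist≤ecc w = subst (_≤ _) (sym (dist-starAdjList w v))
                       (treeDist≤starEcc (coord ps (toℕ w)) (coord ps (toℕ v)) (coord-InStar′ w) (coord-InStar′ v))

-- Sums of eccentricities

sumBelow : (ℕ → ℕ) → ℕ → ℕ
sumBelow h zero    = 0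
sumBelow h (suc n) = h 0 + sumBelow (h ∘ suc) n

sumBelow-cong : ∀ n {g h} → (∀ z → z < n → g z ≡ h z) → sumBelow g n ≡ sumBelow h n
sumBelow-cong zero    eq = refl
sumBelow-cong (suc n) eq = cong₂ _+_ (eq 0 (s≤s z≤n)) (sumBelow-cong n (λ z z<n → eq (suc z) (s≤s z<n)))

sumBelow-+ : ∀ m n h → sumBelow h (m + n) ≡ sumBelow h m + sumBelow (h ∘ (m +_)) n
sumBelow-+ zero    n h = refl
sumBelow-+ (suc m) n h rewrite sumBelow-+ m n (h ∘ suc) = sym (+-assoc (h 0) _ _)

sumBelow-distrib : ∀ n g h → sumBelow (λ z → g z + h z) n ≡ sumBelow g n + sumBelow h n
sumBelow-distrib zero    g h = refl
sumBelow-distrib (suc n) g h rewrite sumBelow-distrib n (g ∘ suc) (h ∘ suc) =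
  +-+-comm (g 0) (h 0) _ _
  where
  +-+-comm : ∀ a b c d → a + b + (c + d) ≡ a + c + (b + d)
  +-+-comm = solve-∀

sumBelow-const : ∀ n c → sumBelow (λ _ → c) n ≡ n * c
sumBelow-const zero    c = refl
sumBelow-const (suc n) c = cong (c +_) (sumBelow-const n c)

sumBelow-suc : ∀ n h → sumBelow h (suc n) ≡ sumBelow h n + h n
sumBelow-suc zero    h = +-identityʳ (h 0)
sumBelow-suc (suc n) h rewrite sumBelow-suc n (h ∘ suc) = sym (+-assoc (h 0) _ _)

sum-tabulate : ∀ n (g : Fin n → ℕ) h → (∀ i → g i ≡ h (toℕ i)) → sum (tabulate g) ≡ sumBelow h n
sum-tabulate zero    g h eq = refl
sum-tabulate (suc n) g h eq = cong₂ _+_ (eq Fin.zero) (sum-tabulate n (g ∘ Fin.suc) (h ∘ suc) (eq ∘ Fin.suc))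

sum-map-allFin : ∀ n (g : Fin n → ℕ) h → (∀ i → g i ≡ h (toℕ i)) → sum (map g (allFin n)) ≡ sumBelow h n
sum-map-allFin n g h eq = trans (cong sum (map-tabulate id g)) (sum-tabulate n g h eq)

sumBranches : (ℕ × ℕ → ℕ) → List ℕ → ℕ
sumBranches g []       = 0
sumBranches g (p ∷ ps) = sumBelow (λ d → g (0 , suc d)) p + sumBranches (λ (i , d) → g (suc i , d)) ps

locate-first : ∀ {p ps y} → y < p → locate (p ∷ ps) y ≡ (0 , suc y)
locate-first {p} {ps} {y} y<p with y <? p
... | yes _   = refl
... | no  y≮p = ⊥-elim (y≮p y<p)

locate-rest : ∀ p ps z → locate (p ∷ ps) (p + z) ≡ (suc (proj₁ (locate ps z)) , proj₂ (locate ps z))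
locate-rest p ps z with p + z <? p
... | yes p+z<p = ⊥-elim (m+n≮m p z p+z<p)
... | no  _     rewrite m+n∸m≡n p z = refl

sumBelow-locate : ∀ ps g → sumBelow (g ∘ locate ps) (sum ps) ≡ sumBranches g ps
sumBelow-locate []       g = refl
sumBelow-locate (p ∷ ps) g = begin
  sumBelow (g ∘ locate (p ∷ ps)) (p + sum ps)
    ≡⟨ sumBelow-+ p (sum ps) _ ⟩
  sumBelow (g ∘ locate (p ∷ ps)) p + sumBelow (g ∘ locate (p ∷ ps) ∘ (p +_)) (sum ps)
    ≡⟨ cong₂ _+_ (sumBelow-cong p (λ y y<p → cong g (locate-first y<p)))
                 (sumBelow-cong (sum ps) (λ z _ → cong g (locate-rest p ps z))) ⟩
  sumBelow (λ d → g (0 , suc d)) p + sumBelow ((λ (i , d) → g (suc i , d)) ∘ locate ps) (sum ps)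
    ≡⟨ cong (_ +_) (sumBelow-locate ps (λ (i , d) → g (suc i , d))) ⟩
  sumBranches g (p ∷ ps) ∎
  where open ≡-Reasoning

eccSum : List ℕ → ℕ
eccSum ps = sum (map (eccV (starAdjList ps)) (allFin (suc (sum ps))))

eccSum-branches : ∀ {a b rest} → Nonincreasing (a ∷ b ∷ rest) → AllPos (a ∷ b ∷ rest) →
                  eccSum (a ∷ b ∷ rest) ≡
                  a + (sumBelow (λ d → starEcc a b (0 , suc d)) a + sumBranches (λ (_ , d) → d + a) (b ∷ rest))
eccSum-branches {a} {b} {rest} ni@(ni-∷ b≤a _) pos = begin
  eccSum ps
    ≡⟨ sum-map-allFin (suc (sum ps)) _ (starEcc a b ∘ coord ps) (eccV-starAdjList ni pos) ⟩
  b ⊔ a + sumBelow (starEcc a b ∘ locate ps) (sum ps)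
    ≡⟨ cong₂ _+_ (m≤n⇒m⊔n≡n b≤a) (sumBelow-locate ps (starEcc a b)) ⟩
  a + sumBranches (starEcc a b) ps ∎
  where
  open ≡-Reasoning
  ps : List ℕ
  ps = a ∷ b ∷ rest

evenInd : ℕ → ℕ
evenInd zero          = 1
evenInd (suc zero)    = 0
evenInd (suc (suc n)) = evenInd n

sumSq : List ℕ → ℕ
sumSq ps = sum (map (λ p → p * p) ps)

twice-sumBelow-suc : ∀ n → 2 * sumBelow suc n ≡ n * n + n
twice-sumBelow-suc zero    = refl
twice-sumBelow-suc (suc n) = begin
  2 * sumBelow suc (suc n)          ≡⟨ cong (2 *_) (sumBelow-suc n suc) ⟩
  2 * (sumBelow suc n + suc n)      ≡⟨ *-distribˡ-+ 2 (sumBelow suc n) (suc n) ⟩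
  2 * sumBelow suc n + 2 * suc n    ≡⟨ cong (_+ 2 * suc n) (twice-sumBelow-suc n) ⟩
  n * n + n + 2 * suc n             ≡⟨ square-step n ⟩
  suc n * suc n + suc n             ∎
  where
  open ≡-Reasoning
  square-step : ∀ n → n * n + n + 2 * suc n ≡ suc n * suc n + suc n
  square-step = solve-∀

twice-branchSum : ∀ a p → 2 * sumBelow (λ d → suc d + a) p ≡ p * p + p + 2 * (p * a)
twice-branchSum a p = begin
  2 * sumBelow (λ d → suc d + a) p               ≡⟨ cong (2 *_) (sumBelow-distrib p suc (λ _ → a)) ⟩
  2 * (sumBelow suc p + sumBelow (λ _ → a) p)    ≡⟨ cong (λ t → 2 * (sumBelow suc p + t)) (sumBelow-const p a) ⟩
  2 * (sumBelow suc p + p * a)                   ≡⟨ *-distribˡ-+ 2 (sumBelow suc p) (p * a) ⟩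
  2 * sumBelow suc p + 2 * (p * a)               ≡⟨ cong (_+ 2 * (p * a)) (twice-sumBelow-suc p) ⟩
  p * p + p + 2 * (p * a)                        ∎
  where open ≡-Reasoning

twice-sumBranches : ∀ a ps → 2 * sumBranches (λ (_ , d) → d + a) ps ≡ sumSq ps + sum ps + 2 * (a * sum ps)
twice-sumBranches a []       = cong (2 *_) (sym (*-zeroʳ a))
twice-sumBranches a (p ∷ ps) = begin
  2 * (sumBelow (λ d → suc d + a) p + sumBranches (λ (_ , d) → d + a) ps)
    ≡⟨ *-distribˡ-+ 2 (sumBelow (λ d → suc d + a) p) _ ⟩
  2 * sumBelow (λ d → suc d + a) p + 2 * sumBranches (λ (_ , d) → d + a) ps
    ≡⟨ cong₂ _+_ (twice-branchSum a p) (twice-sumBranches a ps) ⟩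
  p * p + p + 2 * (p * a) + (sumSq ps + sum ps + 2 * (a * sum ps))
    ≡⟨ regroup p a (sumSq ps) (sum ps) ⟩
  p * p + sumSq ps + (p + sum ps) + 2 * (a * (p + sum ps)) ∎
  where
  open ≡-Reasoning
  regroup : ∀ p a Q S → p * p + p + 2 * (p * a) + (Q + S + 2 * (a * S)) ≡ p * p + Q + (p + S) + 2 * (a * (p + S))
  regroup = solve-∀

m⊔n≡m+[n∸m] : ∀ m n → m ⊔ n ≡ m + (n ∸ m)
m⊔n≡m+[n∸m] m n with ≤-total m n
... | inj₁ m≤n = trans (m≤n⇒m⊔n≡n m≤n) (sym (m+[n∸m]≡n m≤n))
... | inj₂ n≤m = trans (m≥n⇒m⊔n≡m n≤m) (sym (trans (cong (m +_) (m≤n⇒m∸n≡0 n≤m)) (+-identityʳ m)))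

-- Σ_{1 ≤ d ≤ n} (c − 2d)⁺: with c = a − b, the excess of max(d + b, a − d) over d + b along branch 0.
excessSum : ℕ → ℕ → ℕ
excessSum c n = sumBelow (λ d → c ∸ (suc d + suc d)) n

excessSum≡0 : ∀ {c} n → c ≤ 1 → excessSum c n ≡ 0
excessSum≡0 {c} n c≤1 = begin
  excessSum c n             ≡⟨ sumBelow-cong n (λ d _ → m≤n⇒m∸n≡0 (≤-trans c≤1 (s≤s z≤n))) ⟩
  sumBelow (λ _ → 0) n      ≡⟨ sumBelow-const n 0 ⟩
  n * 0                     ≡⟨ *-zeroʳ n ⟩
  0                         ∎
  where open ≡-Reasoning

-- 4 · ⌊(c − 1)² / 4⌋ = (c − 1)² − [c even], kept subtraction-free.
excessSum-closedForm : ∀ c n → c ≤ n → 4 * excessSum c n + evenInd c + 2 * c ≡ c * c + 1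
excessSum-closedForm zero          n _ rewrite excessSum≡0 {0} n z≤n = refl
excessSum-closedForm (suc zero)    n _ rewrite excessSum≡0 {1} n ≤-refl = refl
excessSum-closedForm (suc (suc c)) (suc n) (s≤s c<n) = begin
  4 * excessSum (2 + c) (suc n) + evenInd (2 + c) + 2 * (2 + c)
    ≡⟨ cong (λ t → 4 * (c + t) + evenInd c + 2 * (2 + c))
            (sumBelow-cong n (λ d _ → cong (c ∸_) (+-suc d (suc d)))) ⟩
  4 * (c + excessSum c n) + evenInd c + 2 * (2 + c)
    ≡⟨ regroup c (excessSum c n) (evenInd c) ⟩
  4 * excessSum c n + evenInd c + 2 * c + (4 * c + 4)
    ≡⟨ cong (_+ (4 * c + 4)) (excessSum-closedForm c n (≤-trans (n≤1+n c) c<n)) ⟩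
  c * c + 1 + (4 * c + 4)
    ≡⟨ square-step c ⟩
  (2 + c) * (2 + c) + 1 ∎
  where
  open ≡-Reasoning
  regroup : ∀ c t e → 4 * (c + t) + e + 2 * (2 + c) ≡ 4 * t + e + 2 * c + (4 * c + 4)
  regroup = solve-∀
  square-step : ∀ c → c * c + 1 + (4 * c + 4) ≡ (2 + c) * (2 + c) + 1
  square-step = solve-∀

branch₀-closedForm : ∀ a b → 4 * sumBelow (λ d → starEcc a b (0 , suc d)) a + evenInd (a ∸ b) + 2 * (a ∸ b)
                             ≡ 2 * (a * a + a + 2 * (a * b)) + ((a ∸ b) * (a ∸ b) + 1)
branch₀-closedForm a b = begin
  4 * sumBelow (λ d → starEcc a b (0 , suc d)) a + evenInd c + 2 * c
    ≡⟨ cong (λ t → 4 * t + evenInd c + 2 * c) (trans (sumBelow-cong a (λ d _ → near+excess (suc d)))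
                                                      (sumBelow-distrib a (λ d → suc d + b) _)) ⟩
  4 * (sumBelow (λ d → suc d + b) a + excessSum c a) + evenInd c + 2 * c
    ≡⟨ regroup (sumBelow (λ d → suc d + b) a) (excessSum c a) (evenInd c) c ⟩
  2 * (2 * sumBelow (λ d → suc d + b) a) + (4 * excessSum c a + evenInd c + 2 * c)
    ≡⟨ cong₂ (λ t u → 2 * t + u) (twice-branchSum b a) (excessSum-closedForm c a (m∸n≤m a b)) ⟩
  2 * (a * a + a + 2 * (a * b)) + (c * c + 1) ∎
  where
  open ≡-Reasoning
  c = a ∸ b
  s+[s+b]≡b+[s+s] : ∀ s b → s + (s + b) ≡ b + (s + s)
  s+[s+b]≡b+[s+s] = solve-∀
  near+excess : ∀ s → (s + b) ⊔ (a ∸ s) ≡ s + b + (c ∸ (s + s))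
  near+excess s = trans (m⊔n≡m+[n∸m] (s + b) (a ∸ s)) (cong (s + b +_) (begin
    a ∸ s ∸ (s + b)  ≡⟨ ∸-+-assoc a s (s + b) ⟩
    a ∸ (s + (s + b)) ≡⟨ cong (a ∸_) (s+[s+b]≡b+[s+s] s b) ⟩
    a ∸ (b + (s + s)) ≡⟨ ∸-+-assoc a b (s + s) ⟨
    c ∸ (s + s)       ∎))
  regroup : ∀ x e i c → 4 * (x + e) + i + 2 * c ≡ 2 * (2 * x) + (4 * e + i + 2 * c)
  regroup = solve-∀

-- Comparison under majorization

-- Karamata for x ↦ x², q being majorized by p up to a head start d; peeling off the first parts
-- turns the head start into d + p − q.
sumSq-majorization : ∀ ps qs d M → Nonincreasing ps → Nonincreasing qs → length ps ≡ length qs →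
                     lookup₀ ps 0 + lookup₀ qs 0 ≤ M →
                     (∀ j → sum (take j qs) ≤ d + sum (take j ps)) → sum qs ≡ d + sum ps →
                     sumSq qs ≤ sumSq ps + d * M
sumSq-majorization []       []       d M _ _ _ _ _ _ = z≤n
sumSq-majorization (p ∷ ps) (q ∷ qs) d M nip niq len heads≤M prefix total = begin
  q * q + sumSq qs                  ≤⟨ +-monoʳ-≤ (q * q) (sumSq-majorization ps qs d′ (p + q)
                                         (Nonincreasing-tail nip) (Nonincreasing-tail niq) (suc-injective len)
                                         (+-mono-≤ (lookup₀≤head nip 1) (lookup₀≤head niq 1)) prefix′ total′) ⟩
  q * q + (sumSq ps + d′ * (p + q)) ≡⟨ square-exchange ⟩
  p * p + sumSq ps + d * (p + q)    ≤⟨ +-monoʳ-≤ (p * p + sumSq ps) (*-monoʳ-≤ d heads≤M) ⟩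
  p * p + sumSq ps + d * M          ∎
  where
  open ≤-Reasoning
  q≤d+p : q ≤ d + p
  q≤d+p = subst₂ _≤_ (+-identityʳ q) (cong (d +_) (+-identityʳ p)) (prefix 1)
  d′ = d + p ∸ q
  d+p≡d′+q : d + p ≡ d′ + q
  d+p≡d′+q = sym (m∸n+n≡m q≤d+p)
  shift : ∀ t → d + (p + t) ≡ q + (d′ + t)
  shift t = begin-equality
    d + (p + t)  ≡⟨ +-assoc d p t ⟨
    d + p + t    ≡⟨ cong (_+ t) d+p≡d′+q ⟩
    d′ + q + t   ≡⟨ regroup d′ q t ⟩
    q + (d′ + t) ∎
    where
    regroup : ∀ a b c → a + b + c ≡ b + (a + c)
    regroup = solve-∀
  prefix′ : ∀ j → sum (take j qs) ≤ d′ + sum (take j ps)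
  prefix′ j = +-cancelˡ-≤ q _ _ (≤-trans (prefix (suc j)) (≤-reflexive (shift (sum (take j ps)))))
  total′ : sum qs ≡ d′ + sum ps
  total′ = +-cancelˡ-≡ q _ _ (trans total (shift (sum ps)))
  square-exchange : q * q + (sumSq ps + d′ * (p + q)) ≡ p * p + sumSq ps + d * (p + q)
  square-exchange = +-cancelʳ-≡ (q * p) _ _ (begin-equality
    q * q + (sumSq ps + d′ * (p + q)) + q * p ≡⟨ lhs-form q p d′ (sumSq ps) ⟩
    (d′ + q) * (p + q) + sumSq ps             ≡⟨ cong (λ t → t * (p + q) + sumSq ps) d+p≡d′+q ⟨
    (d + p) * (p + q) + sumSq ps              ≡⟨ rhs-form q p d (sumSq ps) ⟩
    p * p + sumSq ps + d * (p + q) + q * p    ∎)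
    where
    lhs-form : ∀ q p d S → q * q + (S + d * (p + q)) + q * p ≡ (d + q) * (p + q) + S
    lhs-form = solve-∀
    rhs-form : ∀ q p d S → (d + p) * (p + q) + S ≡ p * p + S + d * (p + q) + q * p
    rhs-form = solve-∀

evenInd≤1 : ∀ n → evenInd n ≤ 1
evenInd≤1 zero          = ≤-refl
evenInd≤1 (suc zero)    = z≤n
evenInd≤1 (suc (suc n)) = evenInd≤1 n

evenInd-+-double : ∀ u c → evenInd (u + u + c) ≡ evenInd c
evenInd-+-double zero    c = refl
evenInd-+-double (suc u) c = trans (cong (λ t → evenInd (suc t + c)) (+-suc u u)) (evenInd-+-double u c)

eccSum-closedForm : ∀ {a b rest} → Nonincreasing (a ∷ b ∷ rest) → AllPos (a ∷ b ∷ rest) →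
                    8 * eccSum (a ∷ b ∷ rest) + 2 * evenInd (a ∸ b) + 4 * (a ∸ b)
                    ≡ ⟦ closedForm a b (a ∸ b) (sumSq (b ∷ rest)) (sum (b ∷ rest)) ⟧ℕ
eccSum-closedForm {a} {b} {rest} ni pos = begin
  8 * eccSum (a ∷ b ∷ rest) + 2 * e + 4 * c
    ≡⟨ cong (λ t → 8 * t + 2 * e + 4 * c) (eccSum-branches ni pos) ⟩
  8 * (a + (G + H)) + 2 * e + 4 * c
    ≡⟨ regroup a G H e c ⟩
  8 * a + 2 * (4 * G + e + 2 * c) + 4 * (2 * H)
    ≡⟨ cong₂ (λ t u → 8 * a + 2 * t + 4 * u) (branch₀-closedForm a b) (twice-sumBranches a (b ∷ rest)) ⟩
  8 * a + 2 * (2 * (a * a + a + 2 * (a * b)) + (c * c + 1)) + 4 * (P + S + 2 * (a * S))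
    ≡⟨ final-form a b c P S ⟩
  8 * a * (S + b + 1) + 4 * (a + S + a * a + P) + 2 * (c * c + 1) ∎
  where
  open ≡-Reasoning
  c = a ∸ b
  e = evenInd c
  G = sumBelow (λ d → starEcc a b (0 , suc d)) a
  H = sumBranches (λ (_ , d) → d + a) (b ∷ rest)
  P = sumSq (b ∷ rest)
  S = sum (b ∷ rest)
  regroup : ∀ a g h e c → 8 * (a + (g + h)) + 2 * e + 4 * c ≡ 8 * a + 2 * (4 * g + e + 2 * c) + 4 * (2 * h)
  regroup = solve-∀
  final-form : ∀ a b c P S → 8 * a + 2 * (2 * (a * a + a + 2 * (a * b)) + (c * c + 1)) + 4 * (P + S + 2 * (a * S))
                           ≡ 8 * a * (S + b + 1) + 4 * (a + S + a * a + P) + 2 * (c * c + 1)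
  final-form = solve-∀

comparisonSlack : ℕ → ℕ → ℕ → ℕ → ℕ → ℕ
comparisonSlack a b x y s = 4 * (s * (a ∸ x)) + (a + b ∸ (x + y)) * (a + b + x + y + 2 * (a ∸ x) + 2)

comparison-identity : ∀ {a b x y s sq P Q fp fq ep eq} →
  b ≤ a → y ≤ x → x ≤ a → x + y ≤ a + b → a + (b + s) ≡ x + sq →
  8 * fp + 2 * ep + 4 * (a ∸ b) ≡ ⟦ closedForm a b (a ∸ b) P (b + s) ⟧ℕ →
  8 * fq + 2 * eq + 4 * (x ∸ y) ≡ ⟦ closedForm x y (x ∸ y) Q sq ⟧ℕ →
  8 * fp + 2 * ep + 4 * Q ≡ 8 * fq + 2 * comparisonSlack a b x y s + 4 * P + 4 * ((a ∸ x) * (b + y)) + 2 * eq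
comparison-identity {a} {b} {x} {y} {s} {sq} {P} {Q} {fp} {fq} {ep} {eq} b≤a y≤x x≤a x+y≤a+b total hp hq =
  ⟦⟧ℤ-identity⇒ℕ (weighted fp ep Q) rhs
    (comparison-identityℤ a b x y s P Q fp fq ep eq
      (+[m∸n]≡+m-+n b≤a) (+[m∸n]≡+m-+n y≤x) (pos-+ b s) (m+n≡o+p⇒+p≡+m++n-+o {a} {b + s} {x} {sq} total)
      (+[m∸n]≡+m-+n x≤a) (+[m+n∸[o+p]]≡+m++n-[+o++p] {a} {b} {x} {y} x+y≤a+b)
      (⟦⟧ℕ-identity⇒ℤ (weighted fp ep (a ∸ b)) (closedForm a b (a ∸ b) P (b + s)) hp)
      (⟦⟧ℕ-identity⇒ℤ (weighted fq eq (x ∸ y)) (closedForm x y (x ∸ y) Q sq) hq))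
  where
  u = a ∸ x
  w = a + b ∸ (x + y)
  rhs : Expr ℕ
  rhs = con 8 :* var fq
        :+ con 2 :* (con 4 :* (var s :* var u) :+ var w :* (var a :+ var b :+ var x :+ var y :+ con 2 :* var u :+ con 2))
        :+ con 4 :* var P :+ con 4 :* (var u :* (var b :+ var y)) :+ con 2 :* var eq

-- If the two largest parts move by a total of w, the parity of their difference can change only when w > 0.
evenInd-shift : ∀ {a b x y} → y ≤ x → x ≤ a → x + y ≤ a + b →
                evenInd (a ∸ b) ≤ (a + b ∸ (x + y)) + evenInd (x ∸ y)
evenInd-shift {a} {b} {x} {y} y≤x x≤a x+y≤a+b with a + b ∸ (x + y) | m+[n∸m]≡n x+y≤a+b
... | suc w | _ = ≤-trans (evenInd≤1 (a ∸ b)) (≤-trans (s≤s z≤n) (m≤m+n (suc w) _))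
... | zero  | x+y+0≡a+b = ≤-reflexive (trans (cong evenInd a∸b≡u+u+c₂) (evenInd-+-double u c₂))
  where
  open ≡-Reasoning
  u  = a ∸ x
  c₂ = x ∸ y
  y≡u+b : y ≡ u + b
  y≡u+b = +-cancelˡ-≡ x _ _ (begin
    x + y       ≡⟨ +-identityʳ (x + y) ⟨
    x + y + 0   ≡⟨ x+y+0≡a+b ⟩
    a + b       ≡⟨ cong (_+ b) (m+[n∸m]≡n x≤a) ⟨
    x + u + b   ≡⟨ +-assoc x u b ⟩
    x + (u + b) ∎)
  a≡b+[u+u+c₂] : a ≡ b + (u + u + c₂)
  a≡b+[u+u+c₂] = begin
    a                ≡⟨ m+[n∸m]≡n x≤a ⟨
    x + u            ≡⟨ cong (_+ u) (m+[n∸m]≡n y≤x) ⟨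
    y + c₂ + u       ≡⟨ cong (λ t → t + c₂ + u) y≡u+b ⟩
    u + b + c₂ + u   ≡⟨ regroup u b c₂ ⟩
    b + (u + u + c₂) ∎
    where
    regroup : ∀ u b c → u + b + c + u ≡ b + (u + u + c)
    regroup = solve-∀
  a∸b≡u+u+c₂ : a ∸ b ≡ u + u + c₂
  a∸b≡u+u+c₂ = trans (cong (_∸ b) a≡b+[u+u+c₂]) (m+n∸m≡n b (u + u + c₂))

cancel-comparison : ∀ {f g e₁ e₂ P Q U V} → 8 * f + 2 * e₁ + 4 * Q ≡ 8 * g + 2 * V + 4 * P + 4 * U + 2 * e₂ →
                    Q ≤ P + U → e₁ ≤ V + e₂ → g ≤ f
cancel-comparison {f} {g} {e₁} {e₂} {P} {Q} {U} {V} eq Q≤P+U e₁≤V+e₂ =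
  *-cancelˡ-≤ 8 (+-cancelʳ-≤ (2 * e₁ + 4 * Q) (8 * g) (8 * f) (begin
    8 * g + (2 * e₁ + 4 * Q)
      ≤⟨ +-monoʳ-≤ (8 * g) (+-mono-≤ (*-monoʳ-≤ 2 e₁≤V+e₂) (*-monoʳ-≤ 4 Q≤P+U)) ⟩
    8 * g + (2 * (V + e₂) + 4 * (P + U))
      ≡⟨ regroup g V e₂ P U ⟩
    8 * g + 2 * V + 4 * P + 4 * U + 2 * e₂
      ≡⟨ eq ⟨
    8 * f + 2 * e₁ + 4 * Q
      ≡⟨ +-assoc (8 * f) _ _ ⟩
    8 * f + (2 * e₁ + 4 * Q) ∎))
  where
  open ≤-Reasoning
  regroup : ∀ g V e P U → 8 * g + (2 * (V + e) + 4 * (P + U)) ≡ 8 * g + 2 * V + 4 * P + 4 * U + 2 * e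
  regroup = solve-∀

w≤comparisonSlack : ∀ a b x y s → a + b ∸ (x + y) ≤ comparisonSlack a b x y s
w≤comparisonSlack a b x y s = begin
  w                                         ≡⟨ *-identityʳ w ⟨
  w * 1                                     ≤⟨ *-monoʳ-≤ w (m≤n+m 1 (a + b + x + y + 2 * (a ∸ x) + 1)) ⟩
  w * (a + b + x + y + 2 * (a ∸ x) + 1 + 1) ≡⟨ cong (w *_) (+-assoc (a + b + x + y + 2 * (a ∸ x)) 1 1) ⟩
  w * (a + b + x + y + 2 * (a ∸ x) + 2)     ≤⟨ m≤n+m _ (4 * (s * (a ∸ x))) ⟩
  comparisonSlack a b x y s                 ∎
  where
  open ≤-Reasoning
  w = a + b ∸ (x + y)

majorization⇒eccSum≤ : ∀ {a b x y rp rq} →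
  let ps = a ∷ b ∷ rp; qs = x ∷ y ∷ rq in
  length rp ≡ length rq → Nonincreasing ps → Nonincreasing qs → AllPos ps → AllPos qs →
  (∀ j → sum (take j qs) ≤ sum (take j ps)) → sum ps ≡ sum qs → eccSum qs ≤ eccSum ps
majorization⇒eccSum≤ {a} {b} {x} {y} {rp} {rq} len nip@(ni-∷ b≤a nip′) niq@(ni-∷ y≤x niq′) posp posq
                     prefix total =
  cancel-comparison {e₂ = evenInd (x ∸ y)} {P = sumSq (b ∷ rp)} {U = u * (b + y)} {V = V}
                    identity sumSq-tails evenInd-bound
  where
  u = a ∸ x
  x≤a : x ≤ a
  x≤a = subst₂ _≤_ (+-identityʳ x) (+-identityʳ a) (prefix 1)
  x+y≤a+b : x + y ≤ a + b
  x+y≤a+b = subst₂ _≤_ (cong (x +_) (+-identityʳ y)) (cong (a +_) (+-identityʳ b)) (prefix 2)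
  x+u≡a : x + u ≡ a
  x+u≡a = m+[n∸m]≡n x≤a
  shift : ∀ t → a + t ≡ x + (u + t)
  shift t = trans (cong (_+ t) (sym x+u≡a)) (+-assoc x u t)
  sumSq-tails : sumSq (y ∷ rq) ≤ sumSq (b ∷ rp) + u * (b + y)
  sumSq-tails = sumSq-majorization (b ∷ rp) (y ∷ rq) u (b + y) nip′ niq′ (cong suc len) ≤-refl
    (λ j → +-cancelˡ-≤ x _ _ (≤-trans (prefix (suc j)) (≤-reflexive (shift _))))
    (+-cancelˡ-≡ x _ _ (trans (sym total) (shift _)))
  V = comparisonSlack a b x y (sum rp)
  identity : 8 * eccSum (a ∷ b ∷ rp) + 2 * evenInd (a ∸ b) + 4 * sumSq (y ∷ rq)
           ≡ 8 * eccSum (x ∷ y ∷ rq) + 2 * V + 4 * sumSq (b ∷ rp) + 4 * (u * (b + y)) + 2 * evenInd (x ∸ y)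
  identity = comparison-identity {P = sumSq (b ∷ rp)} {sumSq (y ∷ rq)} {eccSum (a ∷ b ∷ rp)} {eccSum (x ∷ y ∷ rq)}
                                 {evenInd (a ∸ b)} {evenInd (x ∸ y)}
                                 b≤a y≤x x≤a x+y≤a+b total (eccSum-closedForm nip posp) (eccSum-closedForm niq posq)
  evenInd-bound : evenInd (a ∸ b) ≤ V + evenInd (x ∸ y)
  evenInd-bound = ≤-trans (evenInd-shift y≤x x≤a x+y≤a+b) (+-monoˡ-≤ _ (w≤comparisonSlack a b x y (sum rp)))

≻⇒prefixSums≤ : ∀ {k} {p q : Vec ℕ k} → p ≻ q → ∀ j → sum (take j (toList q)) ≤ sum (take j (toList p))
≻⇒prefixSums≤ p≻q zero = z≤n
≻⇒prefixSums≤ {k} {p} {q} p≻q (suc j) with suc j <? k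
... | yes j<k = _≻_.prefix p≻q (suc j) (s≤s z≤n) j<k
... | no  j≮k = subst₂ _≤_ (cong sum (sym (take-all (suc j) (toList q) (length≤ q))))
                           (cong sum (sym (take-all (suc j) (toList p) (length≤ p))))
                           (≤-reflexive (sym (_≻_.total p≻q)))
  where
  length≤ : (v : Vec ℕ k) → length (toList v) ≤ suc j
  length≤ v = subst (_≤ suc j) (sym (length-toList v)) (≮⇒≥ j≮k)

mainTheorem4 : (k : ℕ) → 2 ≤ k → (p q : Vec ℕ k) →
    AllPos (toList p) → AllPos (toList q) → p ≻ q →
    (n : ℕ) → sumV p + 1 ≡ n → sumV q + 1 ≡ n →
    eccStar p ≥ eccStar q
mainTheorem4 1 (s≤s ())
mainTheorem4 (suc (suc k)) _ (a ∷ b ∷ p) (x ∷ y ∷ q) posp posq p≻q _ _ _ =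
  +m/[1+n′]≤+o/[1+n] (_≻_.total p≻q)
    (majorization⇒eccSum≤ (trans (length-toList p) (sym (length-toList q)))
                          (_≻_.x-noninc p≻q) (_≻_.y-noninc p≻q) posp posq (≻⇒prefixSums≤ p≻q) (_≻_.total p≻q))
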